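{- Every flotilla-galaxy $H$ is (isomorphic to) a subtournament of a regular flotilla-galaxy, i.e., there is a regular flotilla-galaxy $H^+$ containing $H$ as an induced subtournament.
   Context: A tournament is a digraph with exactly one arc between any two distinct vertices. For an ordering $\theta=(v_1,\dots,v_n)$ of $V(T)$, an arc $(v_i,v_j)$ is backward if $i>j$, and $B(T,\theta)$ is the undirected graph on $V(T)$ whose edges are the pairs joined by a backward arc. A vertex $v_j$ is between $v_i$ and $v_k$ if $i<j<k$ or $k<j<i$. A left boat in $B(T,\theta)$ is a set $\{v_{i_1},v_{i_2},v_{i_3},v_{i_4}\}$ with $i_1<i_2<i_3<i_4$ and $i_3=i_2+1=i_1+2$ such that the subgraph of $B(T,\theta)$ induced on it has exactly the edges $v_{i_1}v_{i_3}$, $v_{i_1}v_{i_4}$, $v_{i_2}v_{i_4}$; a right boat is defined identically except that $i_4=i_3+1=i_2+2$ instead. A right star is a set $\{v_{i_0},\dots,v_{i_t}\}$ ($t\ge1$) inducing in $B(T,\theta)$ a star $K_{1,t}$ with center $v_{i_t}$ where $i_t$ is the largest index; a left star is such a set inducing a star with center $v_{i_0}$ where $i_0$ is the smallest index; the other vertices are leaves (for $t=1$ either vertex may be taken as center). A star is a left or right star. $T$ is a flotilla-galaxy under $\theta$ if every connected component of $B(T,\theta)$ is a star, a singleton, a left boat or a right boat, no center of a star is between two leaves of another star, and no vertex of a left or right boat is between two leaves of a star; $T$ is a flotilla-galaxy if it is one under some ordering. $T$ is a regular flotilla-galaxy if it is a flotilla-galaxy under some ordering $\theta$ for which $B(T,\theta)$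 has no singleton component. -}

module Defs where

open import Data.Nat using (ℕ)
open import Data.Bool using (Bool; true; false; not)
open import Data.Fin using (Fin; _<_)
open import Data.Fin.Subset using (Subset; _∈_; _∉_)
open import Data.Fin.Permutation using (Permutation′; _⟨$⟩ʳ_)
open import Data.Product using (Σ; ∃; _×_; _,_)
open import Data.Sum using (_⊎_)
open import Data.Empty using (⊥)
open import Data.Unit using (⊤)
open import Relation.Nullary using (¬_)
open import Relation.Binary.PropositionalEquality using (_≡_; _≢_)
open import Function.Definitions using (Injective)

-- Tournaments on vertex set Fin n; arc i j ≡ true means the arc (i , j).

record Tournament : Set where
  field
    n      : ℕ
    arc    : Fin n → Fin n → Bool
    irrefl : ∀ i → arc i i ≡ false
    tourn  : ∀ i j → i ≢ j → arc i j ≡ not (arc j i)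

open Tournament public

module Graph {n : ℕ} (E : Fin n → Fin n → Set) where

  Between : Fin n → Fin n → Fin n → Set
  Between x y z = (x < y × y < z) ⊎ (z < y × y < x)

  IsStar : Fin n → Subset n → Set
  IsStar c L =
    c ∉ L × (∃ λ l → l ∈ L) ×
    (∀ l → l ∈ L → E c l) ×
    (∀ l l' → l ∈ L → l' ∈ L → ¬ E l l')

  LeftStar RightStar : Fin n → Subset n → Set
  LeftStar  c L = IsStar c L × (∀ l → l ∈ L → c < l)
  RightStar c L = IsStar c L × (∀ l → l ∈ L → l < c)

  BoatEdges : Fin n → Fin n → Fin n → Fin n → Set
  BoatEdges a b c d =
    E a c × E a d × E b d × ¬ E a b × ¬ E b c × ¬ E c d

  LeftBoat : Fin n → Fin n → Fin n → Fin n → Set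
  LeftBoat a b c d =
    Data.Fin.toℕ b ≡ ℕ.suc (Data.Fin.toℕ a) ×
    Data.Fin.toℕ c ≡ ℕ.suc (Data.Fin.toℕ b) × c < d × BoatEdges a b c d

  RightBoat : Fin n → Fin n → Fin n → Fin n → Set
  RightBoat a b c d =
    a < b × Data.Fin.toℕ c ≡ ℕ.suc (Data.Fin.toℕ b) ×
    Data.Fin.toℕ d ≡ ℕ.suc (Data.Fin.toℕ c) × BoatEdges a b c d

  data Comp : Set where
    single : Fin n → Comp
    star   : Fin n → Subset n → Comp
    boat   : Fin n → Fin n → Fin n → Fin n → Comp

  Mem : Comp → Fin n → Set
  Mem (single v)     x = x ≡ v
  Mem (star c L)     x = x ≡ c ⊎ x ∈ L
  Mem (boat a b c d) x = x ≡ a ⊎ x ≡ b ⊎ x ≡ c ⊎ x ≡ d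

  -- vertex set closed under adjacency (so, being connected, it is a component)
  Closed : Comp → Set
  Closed K = ∀ x y → Mem K x → E x y → Mem K y

  Shape : Comp → Set
  Shape (single v)     = ⊤
  Shape (star c L)     = LeftStar c L ⊎ RightStar c L
  Shape (boat a b c d) = LeftBoat a b c d ⊎ RightBoat a b c d

  IsSingle : Comp → Set
  IsSingle (single _) = ⊤
  IsSingle _          = ⊥

  record FGStructure : Set where
    field
      comp       : Fin n → Comp
      self       : ∀ v → Mem (comp v) v
      coherent   : ∀ u v → Mem (comp u) v → comp v ≡ comp u
      shape      : ∀ v → Shape (comp v)
      closed     : ∀ v → Closed (comp v)
      centres    : ∀ u w c L c' L' → comp u ≡ star c L → comp w ≡ star c' L' →
                   comp u ≢ comp w →
                   ∀ l₁ l₂ → l₁ ∈ L' → l₂ ∈ L' → ¬ Between l₁ c l₂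
      boats      : ∀ u w a b c d c' L' → comp u ≡ boat a b c d → comp w ≡ star c' L' →
                   ∀ x → Mem (boat a b c d) x →
                   ∀ l₁ l₂ → l₁ ∈ L' → l₂ ∈ L' → ¬ Between l₁ x l₂

-- Backward-arc graph B(T,θ), transported to positions 0..n-1 of θ:
-- θ ⟨$⟩ʳ p is the vertex at position p.

Backward : (T : Tournament) → Permutation′ (n T) → Fin (n T) → Fin (n T) → Set
Backward T θ p q =
  (p < q × arc T (θ ⟨$⟩ʳ q) (θ ⟨$⟩ʳ p) ≡ true) ⊎
  (q < p × arc T (θ ⟨$⟩ʳ p) (θ ⟨$⟩ʳ q) ≡ true)

FlotillaGalaxyUnder : (T : Tournament) → Permutation′ (n T) → Set
FlotillaGalaxyUnder T θ = Graph.FGStructure (Backward T θ)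

FlotillaGalaxy : Tournament → Set
FlotillaGalaxy T = Σ (Permutation′ (n T)) λ θ → FlotillaGalaxyUnder T θ

RegularFlotillaGalaxy : Tournament → Set
RegularFlotillaGalaxy T =
  Σ (Permutation′ (n T)) λ θ → Σ (FlotillaGalaxyUnder T θ) λ S →
    ∀ v → ¬ Graph.IsSingle (Backward T θ) (Graph.FGStructure.comp S v)

SubtournamentOf : Tournament → Tournament → Set
SubtournamentOf H G =
  Σ (Fin (n H) → Fin (n G)) λ f → Injective _≡_ _≡_ f ×
    (∀ i j → arc H i j ≡ arc G (f i) (f j))

-- Let θ witness that H is a flotilla-galaxy and N = |H|. Keep H, ordered by θ, as the first N
-- positions of H⁺ and append new vertices w₀ … w_{N-1}, u₀ … u_{N-1}, y, z in this order. H⁺ is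
-- determined by its backward-arc graph under this ordering, whose new edges are exactly
-- p w_p for each singleton component {p} (a right star with centre w_p), w_p u_p for every other
-- p (a left star with centre w_p), and z y and z u_p for the singletons p (a right star with
-- centre z). So the singletons of B(H, θ) disappear, its other components survive unchanged,
-- and no new singleton arises. The betweenness conditions only concern stars with two or more
-- leaves: the only new one is z's, whose leaves lie to the right of every other centre and of
-- all of H, while the old ones lie inside H, to the left of every new vertex.

module Submission where

open import Defs
open import Data.Bool using (Bool; true; false; not; _∧_; _∨_; if_then_else_)
open import Data.Bool.Properties
  using (not-involutive; not-injective; ∧-conicalˡ; ∧-conicalʳ; ∨-comm; ∨-identityʳ)
open import Data.Empty using (⊥-elim)
open import Data.Fin as F using (Fin; toℕ; _↑ˡ_; _↑ʳ_; splitAt)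
import Data.Fin.Properties as FP
open import Data.Fin.Permutation as Perm using (Permutation′; _⟨$⟩ʳ_; _⟨$⟩ˡ_; inverseˡ; inverseʳ)
open import Data.Fin.Subset using (Subset; _∈_; _∉_; ⊥; ⁅_⁆)
open import Data.Fin.Subset.Properties using (x∈⁅x⁆; x∈⁅y⁆⇒x≡y)
open import Data.Nat as ℕ using (ℕ; suc; _+_)
import Data.Nat.Properties as ℕP
open import Data.Product using (Σ; ∃; _×_; _,_; proj₁; proj₂)
open import Data.Sum using (_⊎_; inj₁; inj₂; [_,_]′)
open import Data.Vec using (_++_; tabulate)
open import Data.Vec.Properties
  using (lookup-++ˡ; lookup-++ʳ; lookup-replicate; lookup∘tabulate; []=⇒lookup; lookup⇒[]=)
open import Function using (_∘_)
open import Function.Bundles using (_⇔_; Equivalence; mk⇔)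
import Function.Properties.Equivalence as ⇔
open import Relation.Binary.Definitions using (tri<; tri≈; tri>)
open import Relation.Binary.PropositionalEquality
open import Relation.Nullary using (¬_; does; yes)
open import Relation.Nullary.Decidable using (dec-true; dec-false)

∧-true : ∀ {a b} → a ∧ b ≡ true → a ≡ true × b ≡ true
∧-true e = ∧-conicalˡ _ _ e , ∧-conicalʳ _ _ e

does-≟ : ∀ {n} (p q : Fin n) → does (p FP.≟ q) ≡ true → p ≡ q
does-≟ p q e with p FP.≟ q
... | yes p≡q = p≡q

-- Tournaments with a prescribed backward-arc graph

-- The arc between positions i and j points away from the smaller position unless b marks it
-- as backward.
orient : Bool → ℕ → ℕ → Bool
orient b i j = if b then does (j ℕ.<? i) else does (i ℕ.<? j)

orient-< : ∀ b {i j} → i ℕ.< j → orient b i j ≡ not b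
orient-< true  i<j = dec-false (_ ℕ.<? _) (ℕP.<⇒≯ i<j)
orient-< false i<j = dec-true (_ ℕ.<? _) i<j

orient-> : ∀ b {i j} → j ℕ.< i → orient b i j ≡ b
orient-> true  j<i = dec-true (_ ℕ.<? _) j<i
orient-> false j<i = dec-false (_ ℕ.<? _) (ℕP.<⇒≯ j<i)

orient-irrefl : ∀ b i → orient b i i ≡ false
orient-irrefl true  i = dec-false (i ℕ.<? i) (ℕP.<-irrefl refl)
orient-irrefl false i = dec-false (i ℕ.<? i) (ℕP.<-irrefl refl)

module _ {n : ℕ} (B : Fin n → Fin n → Bool) (B-sym : ∀ x y → B x y ≡ B y x) where

  fromBackward : Tournament
  fromBackward = record
    { n      = n
    ; arc    = λ x y → orient (B x y) (toℕ x) (toℕ y)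
    ; irrefl = λ x → orient-irrefl (B x x) (toℕ x)
    ; tourn  = tourn′
    }
    where
    tourn′ : ∀ x y → x ≢ y → orient (B x y) (toℕ x) (toℕ y) ≡ not (orient (B y x) (toℕ y) (toℕ x))
    tourn′ x y x≢y with FP.<-cmp x y
    ... | tri< x<y _ _ = begin
      orient (B x y) (toℕ x) (toℕ y)      ≡⟨ orient-< (B x y) x<y ⟩
      not (B x y)                         ≡⟨ cong not (B-sym x y) ⟩
      not (B y x)                         ≡⟨ cong not (orient-> (B y x) x<y) ⟨
      not (orient (B y x) (toℕ y) (toℕ x)) ∎
      where open ≡-Reasoning
    ... | tri≈ _ x≡y _ = ⊥-elim (x≢y x≡y)
    ... | tri> _ _ y<x = begin
      orient (B x y) (toℕ x) (toℕ y)      ≡⟨ orient-> (B x y) y<x ⟩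
      B x y                               ≡⟨ B-sym x y ⟩
      B y x                               ≡⟨ not-involutive (B y x) ⟨
      not (not (B y x))                   ≡⟨ cong not (orient-< (B y x) y<x) ⟨
      not (orient (B y x) (toℕ y) (toℕ x)) ∎
      where open ≡-Reasoning

  Backward-fromBackward : (∀ x → B x x ≡ false) →
                          ∀ x y → Backward fromBackward Perm.id x y ⇔ B x y ≡ true
  Backward-fromBackward B-irrefl x y = mk⇔ to from
    where
    to : Backward fromBackward Perm.id x y → B x y ≡ true
    to (inj₁ (x<y , arc)) = trans (B-sym x y) (trans (sym (orient-> (B y x) x<y)) arc)
    to (inj₂ (y<x , arc)) = trans (sym (orient-> (B x y) y<x)) arc
    from : B x y ≡ true → Backward fromBackward Perm.id x y
    from b with FP.<-cmp x y
    ... | tri< x<y _ _ = inj₁ (x<y , trans (orient-> (B y x) x<y) (trans (B-sym y x) b))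
    ... | tri≈ _ refl _ with () ← trans (sym b) (B-irrefl x)
    ... | tri> _ _ y<x = inj₂ (y<x , trans (orient-> (B x y) y<x) b)

Backward-irrefl : ∀ T θ p → ¬ Backward T θ p p
Backward-irrefl T θ p (inj₁ (p<p , _)) = FP.<-irrefl refl p<p
Backward-irrefl T θ p (inj₂ (p<p , _)) = FP.<-irrefl refl p<p

module _ (T : Tournament) (θ : Permutation′ (n T)) where

  backwardᵇ : Fin (n T) → Fin (n T) → Bool
  backwardᵇ p q = if does (p F.<? q) then arc T (θ ⟨$⟩ʳ q) (θ ⟨$⟩ʳ p)
                                     else arc T (θ ⟨$⟩ʳ p) (θ ⟨$⟩ʳ q)

  backwardᵇ-< : ∀ {p q} → p F.< q → backwardᵇ p q ≡ arc T (θ ⟨$⟩ʳ q) (θ ⟨$⟩ʳ p)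
  backwardᵇ-< {p} {q} p<q rewrite dec-true (p F.<? q) p<q = refl

  backwardᵇ-≮ : ∀ {p q} → ¬ p F.< q → backwardᵇ p q ≡ arc T (θ ⟨$⟩ʳ p) (θ ⟨$⟩ʳ q)
  backwardᵇ-≮ {p} {q} p≮q rewrite dec-false (p F.<? q) p≮q = refl

  backwardᵇ-sym : ∀ p q → backwardᵇ p q ≡ backwardᵇ q p
  backwardᵇ-sym p q with FP.<-cmp p q
  ... | tri< p<q _ _ = trans (backwardᵇ-< p<q) (sym (backwardᵇ-≮ (FP.<-asym p<q)))
  ... | tri≈ _ refl _ = refl
  ... | tri> _ _ q<p = trans (backwardᵇ-≮ (FP.<-asym q<p)) (sym (backwardᵇ-< q<p))

  backwardᵇ-irrefl : ∀ p → backwardᵇ p p ≡ false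
  backwardᵇ-irrefl p = trans (backwardᵇ-≮ (FP.<-irrefl refl)) (irrefl T (θ ⟨$⟩ʳ p))

  Backward⇔backwardᵇ : ∀ p q → Backward T θ p q ⇔ backwardᵇ p q ≡ true
  Backward⇔backwardᵇ p q = mk⇔ to from
    where
    to : Backward T θ p q → backwardᵇ p q ≡ true
    to (inj₁ (p<q , a)) = trans (backwardᵇ-< p<q) a
    to (inj₂ (q<p , a)) = trans (backwardᵇ-≮ (FP.<-asym q<p)) a
    from : backwardᵇ p q ≡ true → Backward T θ p q
    from b with FP.<-cmp p q
    ... | tri< p<q _ _ = inj₁ (p<q , trans (sym (backwardᵇ-< p<q)) b)
    ... | tri≈ _ refl _ with () ← trans (sym b) (backwardᵇ-irrefl p)
    ... | tri> _ _ q<p = inj₂ (q<p , trans (sym (backwardᵇ-≮ (FP.<-asym q<p))) b)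

  arc≡orient-backwardᵇ : ∀ p q →
    arc T (θ ⟨$⟩ʳ p) (θ ⟨$⟩ʳ q) ≡ orient (backwardᵇ p q) (toℕ p) (toℕ q)
  arc≡orient-backwardᵇ p q with FP.<-cmp p q
  ... | tri< p<q p≢q _ = begin
    arc T (θ ⟨$⟩ʳ p) (θ ⟨$⟩ʳ q)          ≡⟨ tourn T _ _ (p≢q ∘ θ-injective) ⟩
    not (arc T (θ ⟨$⟩ʳ q) (θ ⟨$⟩ʳ p))    ≡⟨ cong not (backwardᵇ-< p<q) ⟨
    not (backwardᵇ p q)                  ≡⟨ orient-< (backwardᵇ p q) p<q ⟨
    orient (backwardᵇ p q) (toℕ p) (toℕ q) ∎
    where open ≡-Reasoning
          θ-injective : θ ⟨$⟩ʳ p ≡ θ ⟨$⟩ʳ q → p ≡ q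
          θ-injective e = trans (sym (inverseˡ θ)) (trans (cong (θ ⟨$⟩ˡ_) e) (inverseˡ θ))
  ... | tri≈ _ refl _ = trans (irrefl T (θ ⟨$⟩ʳ p)) (sym (orient-irrefl (backwardᵇ p p) (toℕ p)))
  ... | tri> _ _ q<p = trans (sym (backwardᵇ-≮ (FP.<-asym q<p))) (sym (orient-> (backwardᵇ p q) q<p))

module GraphProperties {n : ℕ} (E : Fin n → Fin n → Set) where
  open Graph E using (Between; IsStar)

  ⁅⁆-all : ∀ {l} {R : Fin n → Set} → R l → ∀ x → x ∈ ⁅ l ⁆ → R x
  ⁅⁆-all {l} Rl x x∈ rewrite x∈⁅y⁆⇒x≡y l x∈ = Rl

  IsStar-⁅⁆ : ∀ {c l} → c ≢ l → E c l → ¬ E l l → IsStar c ⁅ l ⁆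
  IsStar-⁅⁆ {c} {l} c≢l cl ¬ll =
    (λ c∈ → c≢l (x∈⁅y⁆⇒x≡y l c∈)) , (l , x∈⁅x⁆ l) , ⁅⁆-all cl ,
    (λ x x′ x∈ x′∈ → ⁅⁆-all {R = λ x → ¬ E x x′} (⁅⁆-all {R = λ x′ → ¬ E l x′} ¬ll x′ x′∈) x x∈)

  ¬Between-same : ∀ {l c} → ¬ Between l c l
  ¬Between-same (inj₁ (l<c , c<l)) = ℕP.<-asym l<c c<l
  ¬Between-same (inj₂ (l<c , c<l)) = ℕP.<-asym l<c c<l

  ¬Between-above : ∀ {l₁ c l₂} → l₁ F.< c → l₂ F.< c → ¬ Between l₁ c l₂
  ¬Between-above _    l₂<c (inj₁ (_ , c<l₂)) = ℕP.<-asym c<l₂ l₂<c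
  ¬Between-above l₁<c _    (inj₂ (_ , c<l₁)) = ℕP.<-asym c<l₁ l₁<c

  ¬Between-below : ∀ {l₁ c l₂} → c F.< l₁ → c F.< l₂ → ¬ Between l₁ c l₂
  ¬Between-below c<l₁ _    (inj₁ (l₁<c , _)) = ℕP.<-asym l₁<c c<l₁
  ¬Between-below _    c<l₂ (inj₂ (l₂<c , _)) = ℕP.<-asym l₂<c c<l₂

  ¬Between-⁅⁆ : ∀ {l l₁ c l₂} → l₁ ∈ ⁅ l ⁆ → l₂ ∈ ⁅ l ⁆ → ¬ Between l₁ c l₂
  ¬Between-⁅⁆ {l} l₁∈ l₂∈ rewrite x∈⁅y⁆⇒x≡y l l₁∈ | x∈⁅y⁆⇒x≡y l l₂∈ = ¬Between-same

-- Lifting a graph on Fin N to the initial segment of Fin (N + M)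

module _ {N : ℕ} (M : ℕ) where

  ↑ˡ-<⁺ : ∀ {p q : Fin N} → p F.< q → p ↑ˡ M F.< q ↑ˡ M
  ↑ˡ-<⁺ {p} {q} = subst₂ ℕ._<_ (sym (FP.toℕ-↑ˡ p M)) (sym (FP.toℕ-↑ˡ q M))

  ↑ˡ-<⁻ : ∀ {p q : Fin N} → p ↑ˡ M F.< q ↑ˡ M → p F.< q
  ↑ˡ-<⁻ {p} {q} = subst₂ ℕ._<_ (FP.toℕ-↑ˡ p M) (FP.toℕ-↑ˡ q M)

  ↑ˡ-suc : ∀ {p q : Fin N} → toℕ q ≡ suc (toℕ p) → toℕ (q ↑ˡ M) ≡ suc (toℕ (p ↑ˡ M))
  ↑ˡ-suc {p} {q} e = trans (FP.toℕ-↑ˡ q M) (trans e (cong suc (sym (FP.toℕ-↑ˡ p M))))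

  liftSubset : Subset N → Subset (N + M)
  liftSubset L = L ++ ⊥

  ∈-liftSubset⁺ : ∀ {L p} → p ∈ L → p ↑ˡ M ∈ liftSubset L
  ∈-liftSubset⁺ {L} {p} p∈L = lookup⇒[]= _ _ (trans (lookup-++ˡ L ⊥ p) ([]=⇒lookup p∈L))

  ∈-liftSubset⁻ : ∀ {L x} → x ∈ liftSubset L → ∃ λ p → x ≡ p ↑ˡ M × p ∈ L
  ∈-liftSubset⁻ {L} {x} x∈ with splitAt N x in eq
  ... | inj₁ p rewrite sym (FP.splitAt⁻¹-↑ˡ eq) =
    p , refl , lookup⇒[]= p L (trans (sym (lookup-++ˡ L ⊥ p)) ([]=⇒lookup x∈))
  ... | inj₂ r rewrite sym (FP.splitAt⁻¹-↑ʳ eq)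
    with () ← trans (sym ([]=⇒lookup x∈)) (trans (lookup-++ʳ L ⊥ r) (lookup-replicate r false))

module Lift {N M : ℕ} {E : Fin N → Fin N → Set} {E⁺ : Fin (N + M) → Fin (N + M) → Set}
            (E⁺⇔E : ∀ p q → E⁺ (p ↑ˡ M) (q ↑ˡ M) ⇔ E p q) where
  private
    module G  = Graph E
    module G⁺ = Graph E⁺

    lift-edge : ∀ {p q} → E p q → E⁺ (p ↑ˡ M) (q ↑ˡ M)
    lift-edge = Equivalence.from (E⁺⇔E _ _)

    lift-non-edge : ∀ {p q} → ¬ E p q → ¬ E⁺ (p ↑ˡ M) (q ↑ˡ M)
    lift-non-edge ¬e e = ¬e (Equivalence.to (E⁺⇔E _ _) e)

  liftComp : G.Comp → G⁺.Comp
  liftComp (G.single v)     = G⁺.single (v ↑ˡ M)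
  liftComp (G.star c L)     = G⁺.star (c ↑ˡ M) (liftSubset M L)
  liftComp (G.boat a b c d) = G⁺.boat (a ↑ˡ M) (b ↑ˡ M) (c ↑ˡ M) (d ↑ˡ M)

  Mem-liftComp⁺ : ∀ K {r} → G.Mem K r → G⁺.Mem (liftComp K) (r ↑ˡ M)
  Mem-liftComp⁺ (G.single v)     refl                        = refl
  Mem-liftComp⁺ (G.star c L)     (inj₁ refl)                 = inj₁ refl
  Mem-liftComp⁺ (G.star c L)     (inj₂ r∈L)                  = inj₂ (∈-liftSubset⁺ M r∈L)
  Mem-liftComp⁺ (G.boat a b c d) (inj₁ refl)                 = inj₁ refl
  Mem-liftComp⁺ (G.boat a b c d) (inj₂ (inj₁ refl))          = inj₂ (inj₁ refl)
  Mem-liftComp⁺ (G.boat a b c d) (inj₂ (inj₂ (inj₁ refl)))   = inj₂ (inj₂ (inj₁ refl))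
  Mem-liftComp⁺ (G.boat a b c d) (inj₂ (inj₂ (inj₂ refl)))   = inj₂ (inj₂ (inj₂ refl))

  Mem-liftComp⁻ : ∀ K {x} → G⁺.Mem (liftComp K) x → ∃ λ r → x ≡ r ↑ˡ M × G.Mem K r
  Mem-liftComp⁻ (G.single v)     refl                      = v , refl , refl
  Mem-liftComp⁻ (G.star c L)     (inj₁ refl)               = c , refl , inj₁ refl
  Mem-liftComp⁻ (G.star c L)     (inj₂ x∈)                 with ∈-liftSubset⁻ M x∈
  ... | r , refl , r∈L = r , refl , inj₂ r∈L
  Mem-liftComp⁻ (G.boat a b c d) (inj₁ refl)               = a , refl , inj₁ refl
  Mem-liftComp⁻ (G.boat a b c d) (inj₂ (inj₁ refl))        = b , refl , inj₂ (inj₁ refl)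
  Mem-liftComp⁻ (G.boat a b c d) (inj₂ (inj₂ (inj₁ refl))) = c , refl , inj₂ (inj₂ (inj₁ refl))
  Mem-liftComp⁻ (G.boat a b c d) (inj₂ (inj₂ (inj₂ refl))) = d , refl , inj₂ (inj₂ (inj₂ refl))

  liftIsStar : ∀ {c L} → G.IsStar c L → G⁺.IsStar (c ↑ˡ M) (liftSubset M L)
  liftIsStar {c} {L} (c∉L , (l , l∈L) , centre-edges , no-leaf-edges) =
    c∉ , (l ↑ˡ M , ∈-liftSubset⁺ M l∈L) , centre-edges⁺ , no-leaf-edges⁺
    where
    c∉ : c ↑ˡ M ∉ liftSubset M L
    c∉ c∈ with ∈-liftSubset⁻ M c∈
    ... | r , c≡r , r∈L rewrite FP.↑ˡ-injective M c r c≡r = c∉L r∈L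
    centre-edges⁺ : ∀ x → x ∈ liftSubset M L → E⁺ (c ↑ˡ M) x
    centre-edges⁺ x x∈ with ∈-liftSubset⁻ M x∈
    ... | r , refl , r∈L = lift-edge (centre-edges r r∈L)
    no-leaf-edges⁺ : ∀ x y → x ∈ liftSubset M L → y ∈ liftSubset M L → ¬ E⁺ x y
    no-leaf-edges⁺ x y x∈ y∈ with ∈-liftSubset⁻ M x∈ | ∈-liftSubset⁻ M y∈
    ... | r , refl , r∈L | s , refl , s∈L = lift-non-edge (no-leaf-edges r s r∈L s∈L)

  liftLeaves : ∀ {L} {R : Fin (N + M) → Set} → (∀ l → l ∈ L → R (l ↑ˡ M)) →
               ∀ x → x ∈ liftSubset M L → R x
  liftLeaves R-leaves x x∈ with ∈-liftSubset⁻ M x∈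
  ... | r , refl , r∈L = R-leaves r r∈L

  liftBoatEdges : ∀ {a b c d} → G.BoatEdges a b c d →
                  G⁺.BoatEdges (a ↑ˡ M) (b ↑ˡ M) (c ↑ˡ M) (d ↑ˡ M)
  liftBoatEdges (ac , ad , bd , ¬ab , ¬bc , ¬cd) =
    lift-edge ac , lift-edge ad , lift-edge bd ,
    lift-non-edge ¬ab , lift-non-edge ¬bc , lift-non-edge ¬cd

  liftShape : ∀ K → G.Shape K → G⁺.Shape (liftComp K)
  liftShape (G.single v)     _ = _
  liftShape (G.star c L) (inj₁ (star , c<L)) =
    inj₁ (liftIsStar star , liftLeaves (λ l l∈L → ↑ˡ-<⁺ M (c<L l l∈L)))
  liftShape (G.star c L) (inj₂ (star , L<c)) =
    inj₂ (liftIsStar star , liftLeaves (λ l l∈L → ↑ˡ-<⁺ M (L<c l l∈L)))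
  liftShape (G.boat a b c d) (inj₁ (b≡a+1 , c≡b+1 , c<d , edges)) =
    inj₁ (↑ˡ-suc M b≡a+1 , ↑ˡ-suc M c≡b+1 , ↑ˡ-<⁺ M c<d , liftBoatEdges edges)
  liftShape (G.boat a b c d) (inj₂ (a<b , c≡b+1 , d≡c+1 , edges)) =
    inj₂ (↑ˡ-<⁺ M a<b , ↑ˡ-suc M c≡b+1 , ↑ˡ-suc M d≡c+1 , liftBoatEdges edges)

  Between-↑ˡ⁻ : ∀ {a b c} → G⁺.Between (a ↑ˡ M) (b ↑ˡ M) (c ↑ˡ M) → G.Between a b c
  Between-↑ˡ⁻ (inj₁ (a<b , b<c)) = inj₁ (↑ˡ-<⁻ M a<b , ↑ˡ-<⁻ M b<c)
  Between-↑ˡ⁻ (inj₂ (c<b , b<a)) = inj₂ (↑ˡ-<⁻ M c<b , ↑ˡ-<⁻ M b<a)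

-- The extension H⁺

module Extension (H : Tournament) (θ : Permutation′ (n H)) (S : FlotillaGalaxyUnder H θ) where

  N M : ℕ
  N = n H
  M = N + (N + 2)

  open Graph.FGStructure S
  private module G = Graph (Backward H θ)

  isSingleᵇ : G.Comp → Bool
  isSingleᵇ (G.single _) = true
  isSingleᵇ _            = false

  singleton : Fin N → Bool
  singleton p = isSingleᵇ (comp p)

  data New : Set where
    w u : Fin N → New
    y z : New

  data V : Set where
    old : Fin N → V
    new : New → V

  newPos : New → Fin M
  newPos (w p) = p ↑ˡ (N + 2)
  newPos (u p) = N ↑ʳ (p ↑ˡ 2)
  newPos y     = N ↑ʳ (N ↑ʳ F.zero)
  newPos z     = N ↑ʳ (N ↑ʳ F.suc F.zero)

  pos : V → Fin (N + M)
  pos (old p) = p ↑ˡ M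
  pos (new a) = N ↑ʳ newPos a

  lastTwo : Fin 2 → New
  lastTwo F.zero           = y
  lastTwo (F.suc F.zero)   = z

  newAt : Fin M → New
  newAt r = [ w , [ u , lastTwo ]′ ∘ splitAt N ]′ (splitAt N r)

  vertex : Fin (N + M) → V
  vertex x = [ old , new ∘ newAt ]′ (splitAt N x)

  vertex-pos : ∀ v → vertex (pos v) ≡ v
  vertex-pos (old p) rewrite FP.splitAt-↑ˡ N p M = refl
  vertex-pos (new a) rewrite FP.splitAt-↑ʳ N M (newPos a) = cong new (newAt-newPos a)
    where
    newAt-newPos : ∀ a → newAt (newPos a) ≡ a
    newAt-newPos (w p) rewrite FP.splitAt-↑ˡ N p (N + 2) = refl
    newAt-newPos (u p) rewrite FP.splitAt-↑ʳ N (N + 2) (p ↑ˡ 2) | FP.splitAt-↑ˡ N p 2 = refl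
    newAt-newPos y rewrite FP.splitAt-↑ʳ N (N + 2) (N ↑ʳ F.zero {1})
                         | FP.splitAt-↑ʳ N 2 (F.zero {1}) = refl
    newAt-newPos z rewrite FP.splitAt-↑ʳ N (N + 2) (N ↑ʳ F.suc (F.zero {0}))
                         | FP.splitAt-↑ʳ N 2 (F.suc (F.zero {0})) = refl

  pos-vertex : ∀ x → pos (vertex x) ≡ x
  pos-vertex x with splitAt N x in eq
  ... | inj₁ p = FP.splitAt⁻¹-↑ˡ eq
  ... | inj₂ r = trans (cong (N ↑ʳ_) (newPos-newAt r)) (FP.splitAt⁻¹-↑ʳ eq)
    where
    newPos-newAt : ∀ r → newPos (newAt r) ≡ r
    newPos-newAt r with splitAt N r in eq₁
    ... | inj₁ p = FP.splitAt⁻¹-↑ˡ eq₁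
    ... | inj₂ s with splitAt N s in eq₂
    ... | inj₁ p = trans (cong (N ↑ʳ_) (FP.splitAt⁻¹-↑ˡ eq₂)) (FP.splitAt⁻¹-↑ʳ eq₁)
    ... | inj₂ F.zero = trans (cong (N ↑ʳ_) (FP.splitAt⁻¹-↑ʳ eq₂)) (FP.splitAt⁻¹-↑ʳ eq₁)
    ... | inj₂ (F.suc F.zero) = trans (cong (N ↑ʳ_) (FP.splitAt⁻¹-↑ʳ eq₂)) (FP.splitAt⁻¹-↑ʳ eq₁)

  pos-injective : ∀ {v v′} → pos v ≡ pos v′ → v ≡ v′
  pos-injective {v} {v′} e = trans (sym (vertex-pos v)) (trans (cong vertex e) (vertex-pos v′))

  pos-≢ : ∀ {v v′} → v ≢ v′ → pos v ≢ pos v′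
  pos-≢ v≢v′ e = v≢v′ (pos-injective e)

  newRank : New → ℕ
  newRank (w p) = toℕ p
  newRank (u p) = N + toℕ p
  newRank y     = N + N
  newRank z     = N + suc N

  rank : V → ℕ
  rank (old p) = toℕ p
  rank (new a) = N + newRank a

  toℕ-pos : ∀ v → toℕ (pos v) ≡ rank v
  toℕ-pos (old p)     = FP.toℕ-↑ˡ p M
  toℕ-pos (new (w p)) = trans (FP.toℕ-↑ʳ N _) (cong (N +_) (FP.toℕ-↑ˡ p (N + 2)))
  toℕ-pos (new (u p)) = trans (FP.toℕ-↑ʳ N _) (cong (N +_)
                          (trans (FP.toℕ-↑ʳ N _) (cong (N +_) (FP.toℕ-↑ˡ p 2))))
  toℕ-pos (new y)     = trans (FP.toℕ-↑ʳ N _) (cong (N +_) (trans (FP.toℕ-↑ʳ N _)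
                          (cong (N +_) (trans (FP.toℕ-↑ʳ N (F.zero {1})) (ℕP.+-identityʳ N)))))
  toℕ-pos (new z)     = trans (FP.toℕ-↑ʳ N _) (cong (N +_) (trans (FP.toℕ-↑ʳ N _)
                          (cong (N +_) (trans (FP.toℕ-↑ʳ N (F.suc (F.zero {0}))) (ℕP.+-comm N 1)))))

  pos-< : ∀ {v v′} → rank v ℕ.< rank v′ → pos v F.< pos v′
  pos-< {v} {v′} = subst₂ ℕ._<_ (sym (toℕ-pos v)) (sym (toℕ-pos v′))

  old<new : ∀ p a → pos (old p) F.< pos (new a)
  old<new p a = pos-< {old p} {new a} (ℕP.<-≤-trans (FP.toℕ<n p) (ℕP.m≤m+n N _))

  w<u : ∀ p q → pos (new (w p)) F.< pos (new (u q))
  w<u p q = pos-< {new (w p)} {new (u q)}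
              (ℕP.+-monoʳ-< N (ℕP.<-≤-trans (FP.toℕ<n p) (ℕP.m≤m+n N _)))

  w<y : ∀ p → pos (new (w p)) F.< pos (new y)
  w<y p = pos-< {new (w p)} {new y}
            (ℕP.+-monoʳ-< N (ℕP.<-≤-trans (FP.toℕ<n p) (ℕP.m≤m+n N _)))

  u<z : ∀ p → pos (new (u p)) F.< pos (new z)
  u<z p = pos-< {new (u p)} {new z} (ℕP.+-monoʳ-< N (ℕP.+-monoʳ-< N (ℕP.m<n⇒m<1+n (FP.toℕ<n p))))

  y<z : pos (new y) F.< pos (new z)
  y<z = pos-< {new y} {new z} (ℕP.+-monoʳ-< N (ℕP.+-monoʳ-< N (ℕP.n<1+n N)))

  pendantEdge : Fin N → New → Bool
  pendantEdge p (w q) = singleton p ∧ does (p FP.≟ q)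
  pendantEdge _ _     = false

  newEdge : New → New → Bool
  newEdge (w p) (u q) = not (singleton p) ∧ does (p FP.≟ q)
  newEdge (u p) z     = singleton p
  newEdge y     z     = true
  newEdge _     _     = false

  backward : V → V → Bool
  backward (old p) (old q) = backwardᵇ H θ p q
  backward (old p) (new a) = pendantEdge p a
  backward (new a) (old q) = pendantEdge q a
  backward (new a) (new b) = newEdge a b ∨ newEdge b a

  backward-sym : ∀ v v′ → backward v v′ ≡ backward v′ v
  backward-sym (old p) (old q) = backwardᵇ-sym H θ p q
  backward-sym (old p) (new b) = refl
  backward-sym (new a) (old q) = refl
  backward-sym (new a) (new b) = ∨-comm (newEdge a b) (newEdge b a)

  backward-irrefl : ∀ v → backward v v ≡ false
  backward-irrefl (old p)     = backwardᵇ-irrefl H θ p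
  backward-irrefl (new (w p)) = refl
  backward-irrefl (new (u p)) = refl
  backward-irrefl (new y)     = refl
  backward-irrefl (new z)     = refl

  B⁺ : Fin (N + M) → Fin (N + M) → Bool
  B⁺ x x′ = backward (vertex x) (vertex x′)

  B⁺-sym : ∀ x x′ → B⁺ x x′ ≡ B⁺ x′ x
  B⁺-sym x x′ = backward-sym (vertex x) (vertex x′)

  H⁺ : Tournament
  H⁺ = fromBackward B⁺ B⁺-sym

  E⁺ : Fin (N + M) → Fin (N + M) → Set
  E⁺ = Backward H⁺ Perm.id

  private module G⁺ = Graph E⁺

  E⁺⇔backward : ∀ v v′ → E⁺ (pos v) (pos v′) ⇔ backward v v′ ≡ true
  E⁺⇔backward v v′ = subst₂ (λ a b → E⁺ (pos v) (pos v′) ⇔ backward a b ≡ true)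
    (vertex-pos v) (vertex-pos v′)
    (Backward-fromBackward B⁺ B⁺-sym (backward-irrefl ∘ vertex) (pos v) (pos v′))

  backward⇒E⁺ : ∀ v v′ → backward v v′ ≡ true → E⁺ (pos v) (pos v′)
  backward⇒E⁺ v v′ = Equivalence.from (E⁺⇔backward v v′)

  E⁺⇒backward : ∀ v v′ → E⁺ (pos v) (pos v′) → backward v v′ ≡ true
  E⁺⇒backward v v′ = Equivalence.to (E⁺⇔backward v v′)

  E⁺-irrefl : ∀ x → ¬ E⁺ x x
  E⁺-irrefl = Backward-irrefl H⁺ Perm.id

  backward⇒Backward : ∀ {p q} → backward (old p) (old q) ≡ true → Backward H θ p q
  backward⇒Backward = Equivalence.from (Backward⇔backwardᵇ H θ _ _)

  E⁺⇔Backward : ∀ p q → E⁺ (p ↑ˡ M) (q ↑ˡ M) ⇔ Backward H θ p q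
  E⁺⇔Backward p q = ⇔.trans (E⁺⇔backward (old p) (old q)) (⇔.sym (Backward⇔backwardᵇ H θ p q))

  arc-old : ∀ p q → arc H⁺ (pos (old p)) (pos (old q)) ≡ arc H (θ ⟨$⟩ʳ p) (θ ⟨$⟩ʳ q)
  arc-old p q = begin
    orient (B⁺ (p ↑ˡ M) (q ↑ˡ M)) (toℕ (p ↑ˡ M)) (toℕ (q ↑ˡ M))
      ≡⟨ cong₂ (λ a b → orient (backward a b) (toℕ (p ↑ˡ M)) (toℕ (q ↑ˡ M)))
               (vertex-pos (old p)) (vertex-pos (old q)) ⟩
    orient (backwardᵇ H θ p q) (toℕ (p ↑ˡ M)) (toℕ (q ↑ˡ M))
      ≡⟨ cong₂ (orient (backwardᵇ H θ p q)) (FP.toℕ-↑ˡ p M) (FP.toℕ-↑ˡ q M) ⟩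
    orient (backwardᵇ H θ p q) (toℕ p) (toℕ q)
      ≡⟨ arc≡orient-backwardᵇ H θ p q ⟨
    arc H (θ ⟨$⟩ʳ p) (θ ⟨$⟩ʳ q) ∎
    where open ≡-Reasoning

  H⊆H⁺ : SubtournamentOf H H⁺
  H⊆H⁺ = embed , embed-injective , embed-arc
    where
    embed : Fin (n H) → Fin (N + M)
    embed i = pos (old (θ ⟨$⟩ˡ i))
    embed-injective : ∀ {i j} → embed i ≡ embed j → i ≡ j
    embed-injective e =
      trans (sym (inverseʳ θ)) (trans (cong (θ ⟨$⟩ʳ_) (FP.↑ˡ-injective M _ _ e)) (inverseʳ θ))
    embed-arc : ∀ i j → arc H i j ≡ arc H⁺ (embed i) (embed j)
    embed-arc i j =
      sym (trans (arc-old (θ ⟨$⟩ˡ i) (θ ⟨$⟩ˡ j)) (cong₂ (arc H) (inverseʳ θ) (inverseʳ θ)))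

  pendantEdge-true : ∀ p a → pendantEdge p a ≡ true → a ≡ w p × singleton p ≡ true
  pendantEdge-true p (w q) e = cong w (sym (does-≟ p q (proj₂ (∧-true e)))) , proj₁ (∧-true e)

  neighbours-w : ∀ p v → backward (new (w p)) v ≡ true →
                 (v ≡ old p × singleton p ≡ true) ⊎ (v ≡ new (u p) × singleton p ≡ false)
  neighbours-w p (old q) e with pendantEdge-true q (w p) e
  ... | refl , s = inj₁ (refl , s)
  neighbours-w p (new (u q)) e with ∧-true {not (singleton p)} (trans (sym (∨-identityʳ _)) e)
  ... | s , p≡q with refl ← does-≟ p q p≡q = inj₂ (refl , not-injective s)

  neighbours-u : ∀ p v → backward (new (u p)) v ≡ true →
                 (v ≡ new (w p) × singleton p ≡ false) ⊎ (v ≡ new z × singleton p ≡ true)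
  neighbours-u p (new (w q)) e with ∧-true {not (singleton q)} e
  ... | s , q≡p with refl ← does-≟ q p q≡p = inj₁ (refl , not-injective s)
  neighbours-u p (new z) e = inj₂ (refl , trans (sym (∨-identityʳ _)) e)

  neighbours-y : ∀ v → backward (new y) v ≡ true → v ≡ new z
  neighbours-y (new z) _ = refl

  neighbours-z : ∀ v → backward (new z) v ≡ true →
                 (∃ λ q → v ≡ new (u q) × singleton q ≡ true) ⊎ v ≡ new y
  neighbours-z (new (u q)) s = inj₁ (q , refl , s)
  neighbours-z (new y)     _ = inj₂ refl

  open Lift {N} {M} {Backward H θ} {E⁺} E⁺⇔Backward
  open GraphProperties E⁺

  -- Components of B(H⁺, id)

  zLeaves : Subset (N + M)
  zLeaves = tabulate (λ x → backward (new z) (vertex x))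

  ∈-zLeaves : ∀ x → x ∈ zLeaves ⇔ backward (new z) (vertex x) ≡ true
  ∈-zLeaves x = mk⇔ (λ x∈ → trans (sym (lookup∘tabulate _ x)) ([]=⇒lookup x∈))
                    (λ e → lookup⇒[]= x _ (trans (lookup∘tabulate _ x) e))

  ∈-zLeaves-pos : ∀ v → pos v ∈ zLeaves ⇔ backward (new z) v ≡ true
  ∈-zLeaves-pos v = subst (λ v′ → pos v ∈ zLeaves ⇔ backward (new z) v′ ≡ true)
                          (vertex-pos v) (∈-zLeaves (pos v))

  ∈-zLeaves⁺ : ∀ v → backward (new z) v ≡ true → pos v ∈ zLeaves
  ∈-zLeaves⁺ v = Equivalence.from (∈-zLeaves-pos v)

  ∈-zLeaves⁻ : ∀ {x} → x ∈ zLeaves →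
               (∃ λ q → x ≡ pos (new (u q)) × singleton q ≡ true) ⊎ x ≡ pos (new y)
  ∈-zLeaves⁻ {x} x∈ with neighbours-z (vertex x) (Equivalence.to (∈-zLeaves x) x∈)
  ... | inj₁ (q , e , s) = inj₁ (q , trans (sym (pos-vertex x)) (cong pos e) , s)
  ... | inj₂ e           = inj₂ (trans (sym (pos-vertex x)) (cong pos e))

  pendantStar wuStar : Fin N → G⁺.Comp
  pendantStar p = G⁺.star (pos (new (w p))) ⁅ pos (old p) ⁆
  wuStar p      = G⁺.star (pos (new (w p))) ⁅ pos (new (u p)) ⁆

  hubStar : G⁺.Comp
  hubStar = G⁺.star (pos (new z)) zLeaves

  compOf : V → G⁺.Comp
  compOf (old p)     = if singleton p then pendantStar p else liftComp (comp p)
  compOf (new (w p)) = if singleton p then pendantStar p else wuStar p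
  compOf (new (u p)) = if singleton p then hubStar else wuStar p
  compOf (new y)     = hubStar
  compOf (new z)     = hubStar

  data Component : G⁺.Comp → Set where
    liftedStar  : ∀ p {c L} → comp p ≡ G.star c L → Component (liftComp (G.star c L))
    liftedBoat  : ∀ p {a b c d} → comp p ≡ G.boat a b c d → Component (liftComp (G.boat a b c d))
    pendant   : ∀ p → singleton p ≡ true → Component (pendantStar p)
    wu        : ∀ p → singleton p ≡ false → Component (wuStar p)
    hub       : Component hubStar

  component : ∀ v → Component (compOf v)
  component (old p) with comp p in e
  ... | G.single _     = pendant p (cong isSingleᵇ e)
  ... | G.star c L     = liftedStar p e
  ... | G.boat a b c d = liftedBoat p e
  component (new (w p)) with singleton p in s
  ... | true  = pendant p s
  ... | false = wu p s
  component (new (u p)) with singleton p in s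
  ... | true  = hub
  ... | false = wu p s
  component (new y) = hub
  component (new z) = hub

  singleton⇒single : ∀ p → singleton p ≡ true → comp p ≡ G.single p
  singleton⇒single p s with comp p in e
  ... | G.single v = cong G.single (sym (subst (λ K → G.Mem K p) e (self p)))

  Mem-lifted⁻ : ∀ K v → G⁺.Mem (liftComp K) (pos v) → ∃ λ r → v ≡ old r × G.Mem K r
  Mem-lifted⁻ K v m with Mem-liftComp⁻ K m
  ... | r , e , mr = r , pos-injective e , mr

  Mem-⁅⁆star⁻ : ∀ c l v → G⁺.Mem (G⁺.star (pos c) ⁅ pos l ⁆) (pos v) → v ≡ c ⊎ v ≡ l
  Mem-⁅⁆star⁻ c l v (inj₁ e) = inj₁ (pos-injective e)
  Mem-⁅⁆star⁻ c l v (inj₂ m) = inj₂ (pos-injective (x∈⁅y⁆⇒x≡y (pos l) m))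

  Mem-hub⁻ : ∀ v → G⁺.Mem hubStar (pos v) →
             v ≡ new z ⊎ (∃ λ q → v ≡ new (u q) × singleton q ≡ true) ⊎ v ≡ new y
  Mem-hub⁻ v (inj₁ e) = inj₁ (pos-injective e)
  Mem-hub⁻ v (inj₂ m) = inj₂ (neighbours-z v (Equivalence.to (∈-zLeaves-pos v) m))

  compOf-self : ∀ v → G⁺.Mem (compOf v) (pos v)
  compOf-self (old p) with singleton p in s
  ... | true  = inj₂ (x∈⁅x⁆ _)
  ... | false = Mem-liftComp⁺ (comp p) (self p)
  compOf-self (new (w p)) with singleton p
  ... | true  = inj₁ refl
  ... | false = inj₁ refl
  compOf-self (new (u p)) with singleton p in s
  ... | true  = inj₂ (∈-zLeaves⁺ (new (u p)) s)
  ... | false = inj₂ (x∈⁅x⁆ _)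
  compOf-self (new y) = inj₂ (∈-zLeaves⁺ (new y) refl)
  compOf-self (new z) = inj₁ refl

  compOf-old-lifted : ∀ {r K} → comp r ≡ K → isSingleᵇ K ≡ false → compOf (old r) ≡ liftComp K
  compOf-old-lifted e ns rewrite e | ns = refl

  coherent-lifted : ∀ p {K} → comp p ≡ K → isSingleᵇ K ≡ false →
                    ∀ v → G⁺.Mem (liftComp K) (pos v) → compOf v ≡ liftComp K
  coherent-lifted p {K} e ns v m with Mem-lifted⁻ K v m
  ... | r , refl , mr =
    compOf-old-lifted (trans (coherent p r (subst (λ K → G.Mem K r) (sym e) mr)) e) ns

  compOf-coherent : ∀ {K} → Component K → ∀ v → G⁺.Mem K (pos v) → compOf v ≡ K
  compOf-coherent (liftedStar p e) = coherent-lifted p e refl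
  compOf-coherent (liftedBoat p e) = coherent-lifted p e refl
  compOf-coherent (pendant p s) v m with Mem-⁅⁆star⁻ (new (w p)) (old p) v m
  ... | inj₁ refl rewrite s = refl
  ... | inj₂ refl rewrite s = refl
  compOf-coherent (wu p s) v m with Mem-⁅⁆star⁻ (new (w p)) (new (u p)) v m
  ... | inj₁ refl rewrite s = refl
  ... | inj₂ refl rewrite s = refl
  compOf-coherent hub v m with Mem-hub⁻ v m
  ... | inj₁ refl                        = refl
  ... | inj₂ (inj₁ (q , refl , s)) rewrite s = refl
  ... | inj₂ (inj₂ refl)                 = refl

  ClosedOnVertices : G⁺.Comp → Set
  ClosedOnVertices K = ∀ v v′ → G⁺.Mem K (pos v) → backward v v′ ≡ true → G⁺.Mem K (pos v′)

  closedOnVertices⇒Closed : ∀ K → ClosedOnVertices K → G⁺.Closed K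
  closedOnVertices⇒Closed K h x x′ m e = subst (G⁺.Mem K) (pos-vertex x′)
    (h (vertex x) (vertex x′) (subst (G⁺.Mem K) (sym (pos-vertex x)) m)
       (E⁺⇒backward (vertex x) (vertex x′) (subst₂ E⁺ (sym (pos-vertex x)) (sym (pos-vertex x′)) e)))

  closed-lifted : ∀ p {K} → comp p ≡ K → isSingleᵇ K ≡ false → ClosedOnVertices (liftComp K)
  closed-lifted p {K} e ns v v′ m b with Mem-lifted⁻ K v m
  ... | r , refl , mr = neighbour v′ b
    where
    r∈p : G.Mem (comp p) r
    r∈p = subst (λ K → G.Mem K r) (sym e) mr
    neighbour : ∀ v′ → backward (old r) v′ ≡ true → G⁺.Mem (liftComp K) (pos v′)
    neighbour (old q) b = Mem-liftComp⁺ K (subst (λ K → G.Mem K q) e (closed p r q r∈p (backward⇒Backward b)))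
    neighbour (new a) b
      with () ← trans (sym (proj₂ (pendantEdge-true r a b)))
                      (trans (cong isSingleᵇ (trans (coherent p r r∈p) e)) ns)

  closed-pendant : ∀ p → singleton p ≡ true → ClosedOnVertices (pendantStar p)
  closed-pendant p s v v′ m b with Mem-⁅⁆star⁻ (new (w p)) (old p) v m
  closed-pendant p s v v′ m b | inj₁ refl with neighbours-w p v′ b
  ... | inj₁ (refl , _)  = inj₂ (x∈⁅x⁆ _)
  ... | inj₂ (_ , s′) with () ← trans (sym s) s′
  closed-pendant p s v (old q) m b | inj₂ refl
    with closed p p q (self p) (backward⇒Backward b)
  ... | mq rewrite singleton⇒single p s | mq = inj₂ (x∈⁅x⁆ _)
  closed-pendant p s v (new a) m b | inj₂ refl with pendantEdge-true p a b
  ... | refl , _ = inj₁ refl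

  closed-wu : ∀ p → singleton p ≡ false → ClosedOnVertices (wuStar p)
  closed-wu p s v v′ m b with Mem-⁅⁆star⁻ (new (w p)) (new (u p)) v m
  closed-wu p s v v′ m b | inj₁ refl with neighbours-w p v′ b
  ... | inj₁ (_ , s′) with () ← trans (sym s′) s
  ... | inj₂ (refl , _) = inj₂ (x∈⁅x⁆ _)
  closed-wu p s v v′ m b | inj₂ refl with neighbours-u p v′ b
  ... | inj₁ (refl , _) = inj₁ refl
  ... | inj₂ (_ , s′) with () ← trans (sym s′) s

  closed-hub : ClosedOnVertices hubStar
  closed-hub v v′ m b with Mem-hub⁻ v m
  ... | inj₁ refl = inj₂ (∈-zLeaves⁺ v′ b)
  ... | inj₂ (inj₁ (q , refl , s)) with neighbours-u q v′ b
  ...   | inj₁ (_ , s′) with () ← trans (sym s) s′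
  ...   | inj₂ (refl , _) = inj₁ refl
  closed-hub v v′ m b | inj₂ (inj₂ refl) with refl ← neighbours-y v′ b = inj₁ refl

  component-closed : ∀ {K} → Component K → G⁺.Closed K
  component-closed (liftedStar p {c} {L} e) =
    closedOnVertices⇒Closed (liftComp (G.star c L)) (closed-lifted p e refl)
  component-closed (liftedBoat p {a} {b} {c} {d} e) =
    closedOnVertices⇒Closed (liftComp (G.boat a b c d)) (closed-lifted p e refl)
  component-closed (pendant p s) = closedOnVertices⇒Closed (pendantStar p) (closed-pendant p s)
  component-closed (wu p s)      = closedOnVertices⇒Closed (wuStar p) (closed-wu p s)
  component-closed hub           = closedOnVertices⇒Closed hubStar closed-hub

  hub-isStar : G⁺.IsStar (pos (new z)) zLeaves
  hub-isStar = z∉ , (pos (new y) , ∈-zLeaves⁺ (new y) refl) , centre-edge , no-leaf-edge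
    where
    z∉ : pos (new z) ∉ zLeaves
    z∉ m with () ← Equivalence.to (∈-zLeaves-pos (new z)) m
    centre-edge : ∀ l → l ∈ zLeaves → E⁺ (pos (new z)) l
    centre-edge l m = subst (E⁺ (pos (new z))) (pos-vertex l)
                            (backward⇒E⁺ (new z) (vertex l) (Equivalence.to (∈-zLeaves l) m))
    no-leaf-edge : ∀ l l′ → l ∈ zLeaves → l′ ∈ zLeaves → ¬ E⁺ l l′
    no-leaf-edge l l′ m m′ e with ∈-zLeaves⁻ m | ∈-zLeaves⁻ m′
    ... | inj₁ (q , refl , _) | inj₁ (q′ , refl , _) with () ← E⁺⇒backward (new (u q)) (new (u q′)) e
    ... | inj₁ (q , refl , _) | inj₂ refl            with () ← E⁺⇒backward (new (u q)) (new y) e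
    ... | inj₂ refl | inj₁ (q′ , refl , _)            with () ← E⁺⇒backward (new y) (new (u q′)) e
    ... | inj₂ refl | inj₂ refl                       with () ← E⁺⇒backward (new y) (new y) e

  zLeaves<z : ∀ l → l ∈ zLeaves → l F.< pos (new z)
  zLeaves<z l m with ∈-zLeaves⁻ m
  ... | inj₁ (q , refl , _) = u<z q
  ... | inj₂ refl           = y<z

  component-shape : ∀ {K} → Component K → G⁺.Shape K
  component-shape (liftedStar p {c} {L} e) = liftShape (G.star c L) (subst G.Shape e (shape p))
  component-shape (liftedBoat p {a} {b} {c} {d} e) = liftShape (G.boat a b c d) (subst G.Shape e (shape p))
  component-shape (pendant p s)  =
    inj₂ (IsStar-⁅⁆ (pos-≢ {new (w p)} {old p} λ ()) (backward⇒E⁺ (new (w p)) (old p) edge)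
                    (E⁺-irrefl _) ,
          ⁅⁆-all (old<new p (w p)))
    where
    edge : backward (new (w p)) (old p) ≡ true
    edge rewrite s | dec-true (p FP.≟ p) refl = refl
  component-shape (wu p s) =
    inj₁ (IsStar-⁅⁆ (pos-≢ {new (w p)} {new (u p)} λ ()) (backward⇒E⁺ (new (w p)) (new (u p)) edge)
                    (E⁺-irrefl _) ,
          ⁅⁆-all (w<u p p))
    where
    edge : backward (new (w p)) (new (u p)) ≡ true
    edge rewrite s | dec-true (p FP.≟ p) refl = refl
  component-shape hub = inj₂ (hub-isStar , zLeaves<z)

  below-zLeaves : ∀ {c : Fin (N + M)} → (∀ q → c F.< pos (new (u q))) → c F.< pos (new y) →
                  ∀ {l : Fin (N + M)} → l ∈ zLeaves → c F.< l
  below-zLeaves c<u c<y m with ∈-zLeaves⁻ m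
  ... | inj₁ (q , refl , _) = c<u q
  ... | inj₂ refl           = c<y

  old-below-zLeaves : ∀ r {l : Fin (N + M)} → l ∈ zLeaves → pos (old r) F.< l
  old-below-zLeaves r = below-zLeaves (λ q → old<new r (u q)) (old<new r y)

  centre-vs-lifted : ∀ {K c L} p′ {c′ L′} → Component K → K ≡ G⁺.star c L →
                     comp p′ ≡ G.star c′ L′ → K ≢ liftComp (G.star c′ L′) →
                     ∀ {r₁ r₂} → r₁ ∈ L′ → r₂ ∈ L′ → ¬ G⁺.Between (pos (old r₁)) c (pos (old r₂))
  centre-vs-lifted p′ {c′} {L′} (liftedStar p {c} {L} e) refl e′ K≢K′ r₁∈ r₂∈ β =
    centres p p′ c L c′ L′ e e′ (λ eq → K≢K′ (cong liftComp (trans (sym e) (trans eq e′))))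
      _ _ r₁∈ r₂∈ (Between-↑ˡ⁻ β)
  centre-vs-lifted _ (pendant p _) refl _ _ {r₁} {r₂} _ _ =
    ¬Between-above (old<new r₁ (w p)) (old<new r₂ (w p))
  centre-vs-lifted _ (wu p _) refl _ _ {r₁} {r₂} _ _ =
    ¬Between-above (old<new r₁ (w p)) (old<new r₂ (w p))
  centre-vs-lifted _ hub refl _ _ {r₁} {r₂} _ _ =
    ¬Between-above (old<new r₁ z) (old<new r₂ z)

  centre-vs-hub : ∀ {K c L} → Component K → K ≡ G⁺.star c L → K ≢ hubStar →
                  ∀ {l₁ l₂} → l₁ ∈ zLeaves → l₂ ∈ zLeaves → ¬ G⁺.Between l₁ c l₂
  centre-vs-hub (liftedStar p {c} e) refl _ m₁ m₂ =
    ¬Between-below (old-below-zLeaves c m₁) (old-below-zLeaves c m₂)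
  centre-vs-hub (pendant p _) refl _ m₁ m₂ =
    ¬Between-below (below-zLeaves (w<u p) (w<y p) m₁) (below-zLeaves (w<u p) (w<y p) m₂)
  centre-vs-hub (wu p _) refl _ m₁ m₂ =
    ¬Between-below (below-zLeaves (w<u p) (w<y p) m₁) (below-zLeaves (w<u p) (w<y p) m₂)
  centre-vs-hub hub refl K≢K′ = ⊥-elim (K≢K′ refl)

  component-centres : ∀ {K K′ c L c′ L′} → Component K → Component K′ →
             K ≡ G⁺.star c L → K′ ≡ G⁺.star c′ L′ → K ≢ K′ →
             ∀ l₁ l₂ → l₁ ∈ L′ → l₂ ∈ L′ → ¬ G⁺.Between l₁ c l₂
  component-centres _ (pendant _ _) _ refl _ _ _ m₁ m₂ = ¬Between-⁅⁆ m₁ m₂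
  component-centres _ (wu _ _)      _ refl _ _ _ m₁ m₂ = ¬Between-⁅⁆ m₁ m₂
  component-centres k (liftedStar p′ e′) K≡ refl K≢K′ l₁ l₂ m₁ m₂
    with ∈-liftSubset⁻ M m₁ | ∈-liftSubset⁻ M m₂
  ... | _ , refl , r₁∈ | _ , refl , r₂∈ = centre-vs-lifted p′ k K≡ e′ K≢K′ r₁∈ r₂∈
  component-centres k hub K≡ refl K≢K′ _ _ m₁ m₂ = centre-vs-hub k K≡ K≢K′ m₁ m₂

  boat-vertex-vs : ∀ {K′ c′ L′} p {a b c d} → comp p ≡ G.boat a b c d →
                   ∀ {r} → G.Mem (G.boat a b c d) r → Component K′ → K′ ≡ G⁺.star c′ L′ →
                   ∀ l₁ l₂ → l₁ ∈ L′ → l₂ ∈ L′ → ¬ G⁺.Between l₁ (pos (old r)) l₂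
  boat-vertex-vs p e mr (liftedStar p′ {c′} {L′} e′) refl l₁ l₂ m₁ m₂
    with ∈-liftSubset⁻ M m₁ | ∈-liftSubset⁻ M m₂
  ... | r₁ , refl , r₁∈ | r₂ , refl , r₂∈ =
    λ β → boats p p′ _ _ _ _ c′ L′ e e′ _ mr r₁ r₂ r₁∈ r₂∈ (Between-↑ˡ⁻ β)
  boat-vertex-vs p e mr (pendant _ _) refl _ _ m₁ m₂ = ¬Between-⁅⁆ m₁ m₂
  boat-vertex-vs p e mr (wu _ _)      refl _ _ m₁ m₂ = ¬Between-⁅⁆ m₁ m₂
  boat-vertex-vs p e {r} mr hub       refl _ _ m₁ m₂ =
    ¬Between-below (old-below-zLeaves r m₁) (old-below-zLeaves r m₂)

  component-boats : ∀ {K K′ a b c d c′ L′} → Component K → Component K′ →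
           K ≡ G⁺.boat a b c d → K′ ≡ G⁺.star c′ L′ →
           ∀ x → G⁺.Mem (G⁺.boat a b c d) x →
           ∀ l₁ l₂ → l₁ ∈ L′ → l₂ ∈ L′ → ¬ G⁺.Between l₁ x l₂
  component-boats (liftedBoat p {a} {b} {c} {d} e) k′ refl K′≡ x m with Mem-liftComp⁻ (G.boat a b c d) m
  ... | r , refl , mr = boat-vertex-vs p e mr k′ K′≡

  component-¬single : ∀ {K} → Component K → ¬ G⁺.IsSingle K
  component-¬single (liftedStar _ _) ()
  component-¬single (liftedBoat _ _) ()
  component-¬single (pendant _ _)  ()
  component-¬single (wu _ _)       ()
  component-¬single hub            ()

  comp⁺ : Fin (N + M) → G⁺.Comp
  comp⁺ x = compOf (vertex x)

  component⁺ : ∀ x → Component (comp⁺ x)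
  component⁺ x = component (vertex x)

  S⁺ : G⁺.FGStructure
  S⁺ = record
    { comp     = comp⁺
    ; self     = λ x → subst (G⁺.Mem (comp⁺ x)) (pos-vertex x) (compOf-self (vertex x))
    ; coherent = λ x x′ m → compOf-coherent (component⁺ x) (vertex x′)
                             (subst (G⁺.Mem (comp⁺ x)) (sym (pos-vertex x′)) m)
    ; shape    = λ x → component-shape (component⁺ x)
    ; closed   = λ x → component-closed (component⁺ x)
    ; centres  = λ x x′ _ _ _ _ → component-centres (component⁺ x) (component⁺ x′)
    ; boats    = λ x x′ _ _ _ _ _ _ → component-boats (component⁺ x) (component⁺ x′)
    }

  H⁺-regular : RegularFlotillaGalaxy H⁺
  H⁺-regular = Perm.id , S⁺ , λ x → component-¬single (component⁺ x)

lemma7 : (H : Tournament) → FlotillaGalaxy H →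
    Σ Tournament (λ H⁺ → RegularFlotillaGalaxy H⁺ × SubtournamentOf H H⁺)
lemma7 H (θ , S) = H⁺ , H⁺-regular , H⊆H⁺
  where open Extension H θ S
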